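{- Let $G$ be a cancellative $3$-graph. Then for any vertices $u,v\in V(G)$, the $3$-graph $T_v^u(G)$ is also cancellative.
   Context: A $3$-graph $G$ is cancellative if there are no three distinct edges $A,B,C$ of $G$ with $B\triangle C\subset A$. For a vertex $v$, $E_v(G)=\{e\in E(G): v\in e\}$. For vertices $u,v$ of $G$, $T_v^u(G)$ is the $3$-graph with vertex set $V(G)$ and edge set $\big(E(G)\setminus E_v(G)\big)\cup\{(e\setminus\{u\})\cup\{v\} : e\in E_u(G)\setminus E_v(G)\}$. -}

module Defs where

open import Data.Nat using (ℕ)
open import Data.Fin using (Fin)
open import Data.Fin.Subset using (Subset; _∈_; _∉_; _⊆_; _∪_; _─_; _-_; ⁅_⁆; ∣_∣)
open import Data.Product using (Σ; _×_; ∃-syntax)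
open import Data.Sum using (_⊎_)
open import Data.Empty using (⊥)
open import Relation.Binary.PropositionalEquality using (_≡_; _≢_)

Is3Graph : {n : ℕ} → (Subset n → Set) → Set
Is3Graph {n} E = ∀ (e : Subset n) → E e → ∣ e ∣ ≡ 3

_△_ : {n : ℕ} → Subset n → Subset n → Subset n
B △ C = (B ─ C) ∪ (C ─ B)

Cancellative : {n : ℕ} → (Subset n → Set) → Set
Cancellative {n} E =
  ∀ (A B C : Subset n) → E A → E B → E C →
    A ≢ B → A ≢ C → B ≢ C → (B △ C) ⊆ A → ⊥

T : {n : ℕ} → (u v : Fin n) → (Subset n → Set) → (Subset n → Set)
T {n} u v E f =
  (E f × v ∉ f) ⊎
  (∃[ e ] (E e × u ∈ e × v ∉ e × f ≡ ((e - u) ∪ ⁅ v ⁆)))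

{-# OPTIONS --safe #-}
module Submission where

-- Undo the shift: send each edge f of T_v^u(G) to the edge of G it came from,
-- moving v back to u when v ∈ f.  This map preserves B △ C ⊆ A, and it can
-- identify two edges B ≠ C only when they differ both at u and at v; then
-- u, v ∈ B △ C ⊆ A, impossible since no edge of T_v^u(G) contains both u and v.
-- The images of A, B, C need not be distinct, but an image A' = B' forces
-- C' ⊆ B', hence C' = B' as both are 3-sets.  For u = v, T_u^u(G) is a
-- subgraph of G.

open import Defs
open import Data.Nat using (ℕ; _≤_)
import Data.Nat.Properties as ℕ
open import Data.Bool using (Bool; true; false; not; _∧_; _∨_; _xor_)
import Data.Bool as Bool
open import Data.Bool.Properties using (∧-identityʳ; ∧-zeroʳ; ∨-identityʳ; ∨-zeroʳ)
open import Data.Fin using (Fin; zero; suc; _≟_)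
open import Data.Fin.Subset using (Subset; _∈_; _∉_; _⊆_; _∪_; _─_; _-_; ⁅_⁆; ∣_∣; inside; outside)
open import Data.Fin.Subset.Properties
  using (_∈?_; drop-∷-⊆; p⊆q⇒∣p∣≤∣q∣; x∈p∪q⁺; x∈p∧x∉q⇒x∈p─q; x∈⁅x⁆; x∈⁅y⁆⇒x≡y)
open import Data.Vec using ([]; _∷_; here; lookup; tabulate; _[_]≔_)
open import Data.Vec.Properties
  using (≡-dec; []=⇒lookup; lookup⇒[]=; lookup-zipWith; tabulate∘lookup; tabulate-cong; lookup∘update; lookup∘update′)
open import Data.Product using (_×_; _,_; proj₁; proj₂)
open import Data.Sum using (_⊎_; inj₁; inj₂)
open import Data.Empty using (⊥)
open import Function using (_∘_; case_of_)
open import Relation.Nullary using (yes; no; contradiction)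
open import Relation.Binary.PropositionalEquality

module _ {n : ℕ} where

  lookup-ext : {p q : Subset n} → (∀ x → lookup p x ≡ lookup q x) → p ≡ q
  lookup-ext {p} {q} p≗q = begin
    p                    ≡⟨ tabulate∘lookup p ⟨
    tabulate (lookup p)  ≡⟨ tabulate-cong p≗q ⟩
    tabulate (lookup q)  ≡⟨ tabulate∘lookup q ⟩
    q                    ∎
    where open ≡-Reasoning

  ∉⇒lookup≡false : {p : Subset n} {x : Fin n} → x ∉ p → lookup p x ≡ false
  ∉⇒lookup≡false {p} {x} x∉p with lookup p x in eq
  ... | false = refl
  ... | true  = contradiction (lookup⇒[]= x p eq) x∉p

  lookup-⁅x⁆ : (x : Fin n) → lookup ⁅ x ⁆ x ≡ true
  lookup-⁅x⁆ x = []=⇒lookup (x∈⁅x⁆ x)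

  lookup-⁅y⁆ : {x y : Fin n} → x ≢ y → lookup ⁅ y ⁆ x ≡ false
  lookup-⁅y⁆ {y = y} x≢y = ∉⇒lookup≡false (x≢y ∘ x∈⁅y⁆⇒x≡y y)

lookup-─ : ∀ {n} (p q : Subset n) x → lookup (p ─ q) x ≡ lookup p x ∧ not (lookup q x)
lookup-─ (b ∷ p) (true  ∷ q) zero    = sym (∧-zeroʳ b)
lookup-─ (b ∷ p) (false ∷ q) zero    = sym (∧-identityʳ b)
lookup-─ (_ ∷ p) (_     ∷ q) (suc x) = lookup-─ p q x

lookup-∪ : ∀ {n} (p q : Subset n) x → lookup (p ∪ q) x ≡ lookup p x ∨ lookup q x
lookup-∪ p q x = lookup-zipWith _∨_ x p q

lookup-△ : ∀ {n} (p q : Subset n) x → lookup (p △ q) x ≡ lookup p x xor lookup q x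
lookup-△ p q x
  rewrite lookup-∪ (p ─ q) (q ─ p) x | lookup-─ p q x | lookup-─ q p x
  with lookup p x | lookup q x
... | true  | true  = refl
... | true  | false = refl
... | false | true  = refl
... | false | false = refl

module _ {n : ℕ} {A B C : Subset n} where

  △⊆⇒xor : B △ C ⊆ A → ∀ x → lookup B x xor lookup C x ≡ true → lookup A x ≡ true
  △⊆⇒xor B△C⊆A x b⊕c = []=⇒lookup (B△C⊆A (lookup⇒[]= x (B △ C) (trans (lookup-△ B C x) b⊕c)))

  xor⇒△⊆ : (∀ x → lookup B x xor lookup C x ≡ true → lookup A x ≡ true) → B △ C ⊆ A
  xor⇒△⊆ cover {x} x∈B△C =
    lookup⇒[]= x A (cover x (trans (sym (lookup-△ B C x)) ([]=⇒lookup x∈B△C)))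

module _ {n : ℕ} {p q : Subset n} where

  p△q⊆p⇒q⊆p : p △ q ⊆ p → q ⊆ p
  p△q⊆p⇒q⊆p p△q⊆p {x} x∈q with x ∈? p
  ... | yes x∈p = x∈p
  ... | no  x∉p = p△q⊆p (x∈p∪q⁺ (inj₂ (x∈p∧x∉q⇒x∈p─q x∈q x∉p)))

  p△q⊆q⇒p⊆q : p △ q ⊆ q → p ⊆ q
  p△q⊆q⇒p⊆q p△q⊆q {x} x∈p with x ∈? q
  ... | yes x∈q = x∈q
  ... | no  x∉q = p△q⊆q (x∈p∪q⁺ (inj₁ (x∈p∧x∉q⇒x∈p─q x∈p x∉q)))

p⊆q∧∣p∣≡∣q∣⇒p≡q : ∀ {n} {p q : Subset n} → p ⊆ q → ∣ p ∣ ≡ ∣ q ∣ → p ≡ q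
p⊆q∧∣p∣≡∣q∣⇒p≡q {p = []}          {[]}          _   _ = refl
p⊆q∧∣p∣≡∣q∣⇒p≡q {p = outside ∷ p} {outside ∷ q} p⊆q eq =
  cong (outside ∷_) (p⊆q∧∣p∣≡∣q∣⇒p≡q (drop-∷-⊆ p⊆q) eq)
p⊆q∧∣p∣≡∣q∣⇒p≡q {p = inside  ∷ p} {inside  ∷ q} p⊆q eq =
  cong (inside ∷_) (p⊆q∧∣p∣≡∣q∣⇒p≡q (drop-∷-⊆ p⊆q) (ℕ.suc-injective eq))
p⊆q∧∣p∣≡∣q∣⇒p≡q {p = inside  ∷ p} {outside ∷ q} p⊆q eq = case p⊆q here of λ ()
p⊆q∧∣p∣≡∣q∣⇒p≡q {p = outside ∷ p} {inside  ∷ q} p⊆q eq =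
  contradiction (subst (_≤ ∣ q ∣) eq (p⊆q⇒∣p∣≤∣q∣ (drop-∷-⊆ p⊆q))) ℕ.1+n≰n

xor-∨-cover : ∀ {av au bv bu cv cu : Bool} →
  (bv xor cv ≡ true → av ≡ true) → (bu xor cu ≡ true → au ≡ true) →
  (bv ∨ bu) xor (cv ∨ cu) ≡ true → av ∨ au ≡ true
xor-∨-cover {true}                          _  _  _ = refl
xor-∨-cover {false} {bv = true}  {cv = true}  _  _  ()
xor-∨-cover {false} {bv = true}  {cv = false} hv _  _ = contradiction (hv refl) λ ()
xor-∨-cover {false} {bv = false} {cv = true}  hv _  _ = contradiction (hv refl) λ ()
xor-∨-cover {false} {bv = false} {cv = false} _  hu   = hu

∨-injective⊎xor : ∀ {bv bu cv cu : Bool} →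
  (bv ≡ true → bu ≡ false) → (cv ≡ true → cu ≡ false) → bv ∨ bu ≡ cv ∨ cu →
  (bv ≡ cv × bu ≡ cu) ⊎ (bv xor cv ≡ true × bu xor cu ≡ true)
∨-injective⊎xor {true}  {_}  {true}  {_}  ob oc _ = inj₁ (refl , trans (ob refl) (sym (oc refl)))
∨-injective⊎xor {false} {_}  {false} {_}  _  _  bu≡cu = inj₁ (refl , bu≡cu)
∨-injective⊎xor {true}  {bu} {false} {cu} ob _  true≡cu rewrite ob refl | sym true≡cu = inj₂ (refl , refl)
∨-injective⊎xor {false} {bu} {true}  {cu} _  oc bu≡true rewrite oc refl | bu≡true = inj₂ (refl , refl)

Uniform : {n : ℕ} → ℕ → (Subset n → Set) → Set
Uniform {n} k E = ∀ (e : Subset n) → E e → ∣ e ∣ ≡ k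

-- Unlike Cancellative, A may coincide with B or C: this is the form that the
-- reverse shift transports, since it need not keep three edges distinct.
StronglyCancellative : {n : ℕ} → (Subset n → Set) → Set
StronglyCancellative {n} E =
  ∀ (A B C : Subset n) → E A → E B → E C → B ≢ C → (B △ C) ⊆ A → ⊥

module _ {n : ℕ} {E : Subset n → Set} where

  uniform∧cancellative⇒stronglyCancellative :
    ∀ {k} → Uniform k E → Cancellative E → StronglyCancellative E
  uniform∧cancellative⇒stronglyCancellative uniform cancellative A B C eA eB eC B≢C B△C⊆A
    with ≡-dec Bool._≟_ A B | ≡-dec Bool._≟_ A C
  ... | yes refl | _ =
    B≢C (sym (p⊆q∧∣p∣≡∣q∣⇒p≡q (p△q⊆p⇒q⊆p B△C⊆A) (trans (uniform C eC) (sym (uniform B eB)))))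
  ... | no _ | yes refl =
    B≢C (p⊆q∧∣p∣≡∣q∣⇒p≡q (p△q⊆q⇒p⊆q B△C⊆A) (trans (uniform B eB) (sym (uniform C eC))))
  ... | no A≢B | no A≢C = cancellative A B C eA eB eC A≢B A≢C B≢C B△C⊆A

  stronglyCancellative-⊆ : {F : Subset n → Set} → (∀ {f} → F f → E f) →
    StronglyCancellative E → StronglyCancellative F
  stronglyCancellative-⊆ F⊆E sc A B C fA fB fC = sc A B C (F⊆E fA) (F⊆E fB) (F⊆E fC)

  T-self⊆ : {u : Fin n} {f : Subset n} → T u u E f → E f
  T-self⊆ (inj₁ (eF , _))                = eF
  T-self⊆ (inj₂ (_ , _ , u∈e , u∉e , _)) = contradiction u∈e u∉e

module Shift {n : ℕ} (u v : Fin n) (u≢v : u ≢ v) where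

  data Position : Fin n → Set where
    at-u      : Position u
    at-v      : Position v
    elsewhere : ∀ {x} → x ≢ u → x ≢ v → Position x

  position : ∀ x → Position x
  position x with x ≟ u | x ≟ v
  ... | yes refl | _        = at-u
  ... | no _     | yes refl = at-v
  ... | no x≢u   | no x≢v   = elsewhere x≢u x≢v

  shift : Subset n → Subset n
  shift e = (e - u) ∪ ⁅ v ⁆

  unshift : Subset n → Subset n
  unshift f = (f [ u ]≔ (lookup f v ∨ lookup f u)) [ v ]≔ false

  OmitsUOrV : Subset n → Set
  OmitsUOrV f = lookup f v ≡ true → lookup f u ≡ false

  lookup-shift : ∀ e x → lookup (shift e) x ≡ lookup e x ∧ not (lookup ⁅ u ⁆ x) ∨ lookup ⁅ v ⁆ x
  lookup-shift e x rewrite lookup-∪ (e - u) ⁅ v ⁆ x | lookup-─ e ⁅ u ⁆ x = refl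

  lookup-shift-u : ∀ e → lookup (shift e) u ≡ false
  lookup-shift-u e
    rewrite lookup-shift e u | lookup-⁅x⁆ u | lookup-⁅y⁆ u≢v | ∧-zeroʳ (lookup e u) = refl

  lookup-shift-v : ∀ e → lookup (shift e) v ≡ true
  lookup-shift-v e rewrite lookup-shift e v | lookup-⁅x⁆ v = ∨-zeroʳ _

  lookup-shift-other : ∀ e {x} → x ≢ u → x ≢ v → lookup (shift e) x ≡ lookup e x
  lookup-shift-other e {x} x≢u x≢v
    rewrite lookup-shift e x | lookup-⁅y⁆ x≢u | lookup-⁅y⁆ x≢v
    = trans (∨-identityʳ _) (∧-identityʳ _)

  lookup-unshift-u : ∀ f → lookup (unshift f) u ≡ lookup f v ∨ lookup f u
  lookup-unshift-u f =
    trans (lookup∘update′ u≢v (f [ u ]≔ (lookup f v ∨ lookup f u)) false) (lookup∘update u f _)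

  lookup-unshift-v : ∀ f → lookup (unshift f) v ≡ false
  lookup-unshift-v f = lookup∘update v (f [ u ]≔ (lookup f v ∨ lookup f u)) false

  lookup-unshift-other : ∀ f {x} → x ≢ u → x ≢ v → lookup (unshift f) x ≡ lookup f x
  lookup-unshift-other f x≢u x≢v =
    trans (lookup∘update′ x≢v (f [ u ]≔ (lookup f v ∨ lookup f u)) false) (lookup∘update′ x≢u f _)

  unshift-id : ∀ {f} → v ∉ f → unshift f ≡ f
  unshift-id {f} v∉f = lookup-ext (agree ∘ position)
    where
    agree : ∀ {x} → Position x → lookup (unshift f) x ≡ lookup f x
    agree at-u = trans (lookup-unshift-u f) (cong (_∨ lookup f u) (∉⇒lookup≡false v∉f))
    agree at-v = trans (lookup-unshift-v f) (sym (∉⇒lookup≡false v∉f))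
    agree (elsewhere x≢u x≢v) = lookup-unshift-other f x≢u x≢v

  unshift∘shift : ∀ {e} → u ∈ e → v ∉ e → unshift (shift e) ≡ e
  unshift∘shift {e} u∈e v∉e = lookup-ext (agree ∘ position)
    where
    agree : ∀ {x} → Position x → lookup (unshift (shift e)) x ≡ lookup e x
    agree at-u = begin
      lookup (unshift (shift e)) u                ≡⟨ lookup-unshift-u (shift e) ⟩
      lookup (shift e) v ∨ lookup (shift e) u     ≡⟨ cong (_∨ lookup (shift e) u) (lookup-shift-v e) ⟩
      true                                        ≡⟨ []=⇒lookup u∈e ⟨
      lookup e u                                  ∎
      where open ≡-Reasoning
    agree at-v = trans (lookup-unshift-v (shift e)) (sym (∉⇒lookup≡false v∉e))
    agree (elsewhere x≢u x≢v) =
      trans (lookup-unshift-other (shift e) x≢u x≢v) (lookup-shift-other e x≢u x≢v)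

  module _ {E : Subset n → Set} {f : Subset n} where

    T-edge⇒unshift-edge : T u v E f → E (unshift f)
    T-edge⇒unshift-edge (inj₁ (eF , v∉f))                  = subst E (sym (unshift-id v∉f)) eF
    T-edge⇒unshift-edge (inj₂ (e , eE , u∈e , v∉e , refl)) = subst E (sym (unshift∘shift u∈e v∉e)) eE

    T-edge⇒OmitsUOrV : T u v E f → OmitsUOrV f
    T-edge⇒OmitsUOrV (inj₁ (_ , v∉f)) fv = contradiction (lookup⇒[]= v f fv) v∉f
    T-edge⇒OmitsUOrV (inj₂ (e , _ , _ , _ , refl)) _ = lookup-shift-u e

  module _ {A B C : Subset n} where

    unshift-△⊆ : B △ C ⊆ A → unshift B △ unshift C ⊆ unshift A
    unshift-△⊆ B△C⊆A = xor⇒△⊆ (λ x → covered (position x))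
      where
      cover = △⊆⇒xor B△C⊆A
      covered : ∀ {x} → Position x →
        lookup (unshift B) x xor lookup (unshift C) x ≡ true → lookup (unshift A) x ≡ true
      covered at-u
        rewrite lookup-unshift-u A | lookup-unshift-u B | lookup-unshift-u C
        = xor-∨-cover {lookup A v} {lookup A u} {lookup B v} {lookup B u} {lookup C v} {lookup C u}
            (cover v) (cover u)
      covered at-v rewrite lookup-unshift-v B | lookup-unshift-v C = λ ()
      covered (elsewhere x≢u x≢v)
        rewrite lookup-unshift-other A x≢u x≢v | lookup-unshift-other B x≢u x≢v
              | lookup-unshift-other C x≢u x≢v
        = cover _

    unshift-injective : OmitsUOrV A → OmitsUOrV B → OmitsUOrV C → B △ C ⊆ A →
      unshift B ≡ unshift C → B ≡ C
    unshift-injective oA oB oC B△C⊆A eq = lookup-ext (agree ∘ position)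
      where
      cover = △⊆⇒xor B△C⊆A
      eq-at : ∀ x → lookup (unshift B) x ≡ lookup (unshift C) x
      eq-at x = cong (λ f → lookup f x) eq
      agree-uv : lookup B v ≡ lookup C v × lookup B u ≡ lookup C u
      agree-uv
        with ∨-injective⊎xor oB oC
               (trans (sym (lookup-unshift-u B)) (trans (eq-at u) (lookup-unshift-u C)))
      ... | inj₁ same = same
      ... | inj₂ (v∈B△C , u∈B△C) =
        contradiction (trans (sym (oA (cover v v∈B△C))) (cover u u∈B△C)) λ ()
      agree : ∀ {x} → Position x → lookup B x ≡ lookup C x
      agree at-u = proj₂ agree-uv
      agree at-v = proj₁ agree-uv
      agree (elsewhere x≢u x≢v) =
        trans (sym (lookup-unshift-other B x≢u x≢v))
              (trans (eq-at _) (lookup-unshift-other C x≢u x≢v))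

  T-stronglyCancellative : {E : Subset n → Set} →
    StronglyCancellative E → StronglyCancellative (T u v E)
  T-stronglyCancellative sc A B C tA tB tC B≢C B△C⊆A =
    sc (unshift A) (unshift B) (unshift C)
       (T-edge⇒unshift-edge tA) (T-edge⇒unshift-edge tB) (T-edge⇒unshift-edge tC)
       (B≢C ∘ unshift-injective (T-edge⇒OmitsUOrV tA) (T-edge⇒OmitsUOrV tB) (T-edge⇒OmitsUOrV tC) B△C⊆A)
       (unshift-△⊆ B△C⊆A)

lemma3p2 : (n : ℕ) (E : Subset n → Set) → Is3Graph E → Cancellative E →
    (u v : Fin n) → Cancellative (T u v E)
lemma3p2 n E 3-graph cancellative u v A B C tA tB tC _ _ = T-sc A B C tA tB tC
  where
  sc : StronglyCancellative E
  sc = uniform∧cancellative⇒stronglyCancellative 3-graph cancellative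
  T-sc : StronglyCancellative (T u v E)
  T-sc with u ≟ v
  ... | yes refl = stronglyCancellative-⊆ T-self⊆ sc
  ... | no u≢v   = Shift.T-stronglyCancellative u v u≢v sc
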